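{- Let $r \ge 2$ be a uniformity, let $k \not\equiv 0 \pmod r$ be a residue, and let $p \ge 2$ be a divisor of $r/\gcd(r,k)$. Let $\mathcal{H}$ be the following $r$-graph: its vertex set $V$ is partitioned into parts $V_1,\ldots,V_p$ whose sizes differ by at most one, and an $r$-set $\{x_1,\ldots,x_r\}$ of vertices with $x_j \in V_{i_j}$ ($1\le j\le r$) is an edge if and only if $\sum_{j=1}^r i_j \equiv 1 \pmod p$. Then $\mathcal{H}$ contains no member of $\mathcal{C}_{\equiv k}^r\text{ - }\mathrm{hom}$ (as a subgraph).
   Context: An $r$-graph is an $r$-uniform hypergraph. For $\ell > r$, the tight cycle $\mathcal{C}_\ell^r$ is the $r$-graph with vertex set $\{0,\ldots,\ell-1\}$ and edges $\{i,i+1,\ldots,i+r-1\}$ ($0\le i<\ell$, indices modulo $\ell$). $\mathcal{C}_{\equiv k}^r$ is the family of all tight cycles $\mathcal{C}_\ell^r$ ($\ell>r$) with $\ell \equiv k \pmod r$. A homomorphism from an $r$-graph $\mathcal{H}_1$ to an $r$-graph $\mathcal{H}_2$ is a map $V(\mathcal{H}_1)\to V(\mathcal{H}_2)$ sending edges to edges; $\mathcal{H}_2$ is a homomorphic image of $\mathcal{H}_1$ if some homomorphism induces a surjection from $E(\mathcal{H}_1)$ onto $E(\mathcal{H}_2)$. For a family $\mathcal{F}$, $\mathcal{F}\text{ - }\mathrm{hom}$ denotes the family of all homomorphic images of members of $\mathcal{F}$. -}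

module Defs where

open import Data.Nat using (ℕ; zero; suc; _+_; _∸_; _<_; _<?_; _%_; _/_; NonZero)
open import Data.Bool using (Bool; true; false; _∧_; _∨_; if_then_else_)
open import Data.Fin using (Fin; toℕ; _≟_)
open import Data.Fin.Subset using (Subset; ∣_∣)
open import Data.Vec using (Vec; []; _∷_; lookup; tabulate)
open import Data.Product using (Σ; ∃; _×_; _,_)
open import Function.Definitions using (Injective)
open import Relation.Binary.PropositionalEquality using (_≡_)
open import Relation.Nullary.Decidable using (⌊_⌋)

record HGraph : Set₁ where
  field
    n    : ℕ
    Edge : Subset n → Set
open HGraph public

IsRGraph : ℕ → HGraph → Set
IsRGraph r G = ∀ e → Edge G e → ∣ e ∣ ≡ r

anyFin : ∀ n → (Fin n → Bool) → Bool
anyFin zero    f = false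
anyFin (suc n) f = f Fin.zero ∨ anyFin n (λ i → f (Fin.suc i))

image : ∀ {n m} → (Fin n → Fin m) → Subset n → Subset m
image {n} f s = tabulate λ j → anyFin n (λ i → lookup s i ∧ ⌊ f i ≟ j ⌋)

IsHom : (G₁ G₂ : HGraph) → (Fin (n G₁) → Fin (n G₂)) → Set
IsHom G₁ G₂ f = ∀ e → Edge G₁ e → Edge G₂ (image f e)

HomImage : (G₁ G₂ : HGraph) → Set
HomImage G₁ G₂ = Σ (Fin (n G₁) → Fin (n G₂)) λ f →
  IsHom G₁ G₂ f × (∀ e₂ → Edge G₂ e₂ → Σ (Subset (n G₁)) λ e₁ → Edge G₁ e₁ × image f e₁ ≡ e₂)

ContainsSubgraph : (H F : HGraph) → Set
ContainsSubgraph H F = Σ (Fin (n F) → Fin (n H)) λ g → Injective _≡_ _≡_ g × IsHom F H g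

-- Tight cycle C^r_ℓ on vertex set {0,…,ℓ-1} (ℓ = suc m): edges are the windows
-- {i, i+1, …, i+r-1} (mod ℓ), i.e. the sets { j | (j - i) mod ℓ < r }.
window : ∀ m (r : ℕ) → Fin (suc m) → Subset (suc m)
window m r i = tabulate λ j → ⌊ ((toℕ j + suc m ∸ toℕ i) % suc m) <? r ⌋

TightCycle : (ℓ r : ℕ) → HGraph
TightCycle zero    r = record { n = zero ; Edge = λ _ → Data.Empty.⊥ }
  where import Data.Empty
TightCycle (suc m) r = record { n = suc m ; Edge = λ e → Σ (Fin (suc m)) λ i → window m r i ≡ e }

sumOver : ∀ {n} → Subset n → (Fin n → ℕ) → ℕ
sumOver []          f = 0
sumOver (b ∷ s)     f = (if b then f Fin.zero else 0) + sumOver s (λ i → f (Fin.suc i))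

partSize : ∀ {n p} → (Fin n → Fin p) → Fin p → ℕ
partSize {n} part a = ∣ tabulate (λ x → ⌊ part x ≟ a ⌋) ∣

-- The construction H: vertices Fin n, part x ∈ Fin p is the (0-based) index of the part
-- containing x (paper's index = toℕ (part x) + 1); an r-set is an edge iff the sum of the
-- (1-based) part indices of its vertices is ≡ 1 (mod p).
ConstrH : (r p n : ℕ) .{{_ : NonZero p}} → (Fin n → Fin p) → HGraph
ConstrH r p n part = record
  { n = n
  ; Edge = λ e → (∣ e ∣ ≡ r) × (sumOver e (λ x → suc (toℕ (part x))) % p ≡ 1 % p) }

-- m / d (only used with d ≠ 0; the value for d = 0 is irrelevant)
divBy : ℕ → ℕ → ℕ
divBy m zero    = 0
divBy m (suc d) = m / suc d

{-# OPTIONS --safe #-}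
-- Compose the homomorphism C^r_ℓ → F with the embedding F → H and colour every vertex of
-- the cycle by the (1-based) index of the part containing its image. Both maps are
-- injective on each window of r consecutive cycle vertices, because windows and edges
-- all have r vertices; so every window has colour sum ≡ 1 (mod p). Comparing consecutive
-- windows shows that the colour sequence, read mod p, has period r; it also has period ℓ,
-- hence period k (as ℓ ≡ k mod r) and finally period d = gcd(r, k). A window thus splits
-- into r/d blocks with equal sums mod p, so its sum is ≡ 0 (mod p) since p ∣ r/d, which
-- contradicts ≡ 1 for p ≥ 2.
module Submission where

open import Defs
open import Data.Bool using (Bool; true; false; _∧_; _∨_)
open import Data.Fin using (Fin; zero; suc; toℕ; _≟_)
open import Data.Fin.Properties using (toℕ-injective; toℕ-fromℕ<; toℕ<n; toℕ-inject₁; toℕ-fromℕ)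
open import Data.Fin.Subset using (Subset; ∣_∣)
open import Data.Nat using (ℕ; zero; suc; _+_; _*_; _∸_; _≤_; _<_; _%_; _<?_; NonZero; z≤n; s≤s)
open import Data.Nat.DivMod
  using (_/_; _mod_; %-distribˡ-+; m%n%n≡m%n; m%n≤n; m%n<n; %-remove-+ˡ; [m+n]%n≡m%n; m<n⇒m%n≡m;
         m≡m%n+[m/n]*n; m/n*n≡m)
open import Data.Nat.Divisibility using (_∣_; ∣-refl; 0∣⇒≡0; ∣m⇒∣m*n; n∣m⇒m%n≡0; m%n≡0⇒n∣m; ∣1⇒≡1)
open import Data.Nat.GCD using (gcd; gcd-GCD; gcd[m,n]∣m; module Bézout)
open import Data.Nat.Properties
  using (+-*-semiring; +-assoc; +-comm; +-identityʳ; *-identityˡ; *-identityʳ; *-assoc; +-suc; +-cancelˡ-≡;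
         +-mono-≤; +-monoʳ-≤; +-mono-<-≤; ≤-trans; ≤-refl; ≤-reflexive; ≤-antisym; ≮⇒≥; <-irrefl; <⇒≤; >⇒≢;
         +-∸-assoc; m∸n+n≡m; m+[n∸m]≡n)
open import Algebra.Properties.Semiring.Sum +-*-semiring
  using (sum; sum-syntax; ∑-comm; *-distribˡ-sum; *-distribʳ-sum; sum-cong-≗; sum-init-last; sum-replicate-zero)
open import Data.Product using (_,_; proj₁; proj₂)
open import Data.Vec using ([]; _∷_; lookup)
open import Data.Vec.Functional using (Vector)
open import Data.Vec.Properties using (lookup∘tabulate)
open import Function using (_∘_)
open import Relation.Binary.PropositionalEquality
  using (_≡_; refl; sym; trans; cong; cong₂; subst; module ≡-Reasoning)
open import Relation.Nullary using (¬_)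
open import Relation.Nullary.Decidable using (⌊_⌋; isYes≗does; ⌊⌋-map′)

open ≡-Reasoning

⟦_⟧ : Bool → ℕ
⟦ true ⟧  = 1
⟦ false ⟧ = 0

⟦∨⟧≤⟦⟧+⟦⟧ : ∀ a b → ⟦ a ∨ b ⟧ ≤ ⟦ a ⟧ + ⟦ b ⟧
⟦∨⟧≤⟦⟧+⟦⟧ true  b = s≤s z≤n
⟦∨⟧≤⟦⟧+⟦⟧ false b = ≤-refl

⟦∧⟧≡⟦⟧*⟦⟧ : ∀ a b → ⟦ a ∧ b ⟧ ≡ ⟦ a ⟧ * ⟦ b ⟧
⟦∧⟧≡⟦⟧*⟦⟧ true  b = sym (+-identityʳ ⟦ b ⟧)
⟦∧⟧≡⟦⟧*⟦⟧ false b = refl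

⟦anyFin⟧≤∑ : ∀ n (P : Fin n → Bool) → ⟦ anyFin n P ⟧ ≤ ∑[ x < n ] ⟦ P x ⟧
⟦anyFin⟧≤∑ zero    P = z≤n
⟦anyFin⟧≤∑ (suc n) P =
  ≤-trans (⟦∨⟧≤⟦⟧+⟦⟧ (P zero) _) (+-monoʳ-≤ ⟦ P zero ⟧ (⟦anyFin⟧≤∑ n (P ∘ suc)))

∑-δ : ∀ {n} (a : Fin n) (h : Fin n → ℕ) → ∑[ y < n ] (⟦ ⌊ a ≟ y ⌋ ⟧ * h y) ≡ h a
∑-δ {suc n} zero    h =
  trans (cong₂ _+_ (*-identityˡ (h zero)) (sum-replicate-zero n)) (+-identityʳ (h zero))
∑-δ {suc n} (suc a) h =
  trans (sum-cong-≗ (λ y → cong (λ b → ⟦ b ⟧ * h (suc y)) (⌊⌋-map′ _ _ (a ≟ y)))) (∑-δ a (h ∘ suc))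

∑-mono-≤ : ∀ {n} {f g : Vector ℕ n} → (∀ j → f j ≤ g j) → sum f ≤ sum g
∑-mono-≤ {zero}  f≤g = z≤n
∑-mono-≤ {suc n} f≤g = +-mono-≤ (f≤g zero) (∑-mono-≤ (f≤g ∘ suc))

≤∧∑-≡⇒≗ : ∀ {n} {f g : Vector ℕ n} → (∀ j → f j ≤ g j) → sum f ≡ sum g → ∀ j → f j ≡ g j
≤∧∑-≡⇒≗ {suc n} {f} {g} f≤g eq j = pointwise j
  where
  head-eq : f zero ≡ g zero
  head-eq = ≤-antisym (f≤g zero)
    (≮⇒≥ (λ f₀<g₀ → <-irrefl eq (+-mono-<-≤ f₀<g₀ (∑-mono-≤ (f≤g ∘ suc)))))
  pointwise : ∀ j → f j ≡ g j
  pointwise zero    = head-eq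
  pointwise (suc j) =
    ≤∧∑-≡⇒≗ (f≤g ∘ suc) (+-cancelˡ-≡ (f zero) _ _ (trans eq (cong (_+ _) (sym head-eq)))) j

sumOver-∑ : ∀ {n} (s : Subset n) (h : Fin n → ℕ) → sumOver s h ≡ ∑[ j < n ] (⟦ lookup s j ⟧ * h j)
sumOver-∑ []          h = refl
sumOver-∑ (true ∷ s)  h = cong₂ _+_ (sym (+-identityʳ (h zero))) (sumOver-∑ s (h ∘ suc))
sumOver-∑ (false ∷ s) h = sumOver-∑ s (h ∘ suc)

∣s∣≡sumOver-1 : ∀ {n} (s : Subset n) → ∣ s ∣ ≡ sumOver s (λ _ → 1)
∣s∣≡sumOver-1 []          = refl
∣s∣≡sumOver-1 (true ∷ s)  = cong suc (∣s∣≡sumOver-1 s)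
∣s∣≡sumOver-1 (false ∷ s) = ∣s∣≡sumOver-1 s

module _ {a b} (f : Fin a → Fin b) (s : Subset a) where

  fibreSize : Fin b → ℕ
  fibreSize y = ∑[ x < a ] (⟦ lookup s x ⟧ * ⟦ ⌊ f x ≟ y ⌋ ⟧)

  ∑-fibreSize-* : ∀ h → ∑[ y < b ] (fibreSize y * h y) ≡ sumOver s (h ∘ f)
  ∑-fibreSize-* h = begin
    ∑[ y < b ] (fibreSize y * h y)
      ≡⟨ sum-cong-≗ (λ y → *-distribʳ-sum (h y) (λ x → ⟦ lookup s x ⟧ * ⟦ ⌊ f x ≟ y ⌋ ⟧)) ⟩
    ∑[ y < b ] ∑[ x < a ] (⟦ lookup s x ⟧ * ⟦ ⌊ f x ≟ y ⌋ ⟧ * h y)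
      ≡⟨ ∑-comm (λ x y → ⟦ lookup s x ⟧ * ⟦ ⌊ f x ≟ y ⌋ ⟧ * h y) ⟨
    ∑[ x < a ] ∑[ y < b ] (⟦ lookup s x ⟧ * ⟦ ⌊ f x ≟ y ⌋ ⟧ * h y)
      ≡⟨ sum-cong-≗ (λ x → trans (sum-cong-≗ (λ y → *-assoc ⟦ lookup s x ⟧ _ (h y)))
                                 (sym (*-distribˡ-sum ⟦ lookup s x ⟧ (λ y → ⟦ ⌊ f x ≟ y ⌋ ⟧ * h y)))) ⟩
    ∑[ x < a ] (⟦ lookup s x ⟧ * ∑[ y < b ] (⟦ ⌊ f x ≟ y ⌋ ⟧ * h y))
      ≡⟨ sum-cong-≗ (λ x → cong (⟦ lookup s x ⟧ *_) (∑-δ (f x) h)) ⟩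
    ∑[ x < a ] (⟦ lookup s x ⟧ * h (f x))
      ≡⟨ sumOver-∑ s (h ∘ f) ⟨
    sumOver s (h ∘ f) ∎

  ∈image≤fibreSize : ∀ y → ⟦ lookup (image f s) y ⟧ ≤ fibreSize y
  ∈image≤fibreSize y = subst (λ b → ⟦ b ⟧ ≤ fibreSize y) (sym (lookup∘tabulate _ y))
    (≤-trans (⟦anyFin⟧≤∑ a (λ x → lookup s x ∧ ⌊ f x ≟ y ⌋))
             (≤-reflexive (sum-cong-≗ (λ x → ⟦∧⟧≡⟦⟧*⟦⟧ (lookup s x) ⌊ f x ≟ y ⌋))))

  -- Equal cardinalities force every fibre over the image to be a singleton: the image
  -- indicator is bounded by the fibre sizes and both have the same total.
  sumOver-image : ∣ image f s ∣ ≡ ∣ s ∣ → ∀ h → sumOver (image f s) h ≡ sumOver s (h ∘ f)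
  sumOver-image ∣fs∣≡∣s∣ h = begin
    sumOver (image f s) h                        ≡⟨ sumOver-∑ (image f s) h ⟩
    ∑[ y < b ] (⟦ lookup (image f s) y ⟧ * h y)  ≡⟨ sum-cong-≗ (λ y → cong (_* h y) (∈image≡fibreSize y)) ⟩
    ∑[ y < b ] (fibreSize y * h y)               ≡⟨ ∑-fibreSize-* h ⟩
    sumOver s (h ∘ f)                            ∎
    where
    ∑∈image≡∑fibreSize : ∑[ y < b ] ⟦ lookup (image f s) y ⟧ ≡ ∑[ y < b ] fibreSize y
    ∑∈image≡∑fibreSize = begin
      ∑[ y < b ] ⟦ lookup (image f s) y ⟧        ≡⟨ sum-cong-≗ (λ y → *-identityʳ ⟦ lookup (image f s) y ⟧) ⟨
      ∑[ y < b ] (⟦ lookup (image f s) y ⟧ * 1)  ≡⟨ sumOver-∑ (image f s) _ ⟨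
      sumOver (image f s) (λ _ → 1)              ≡⟨ ∣s∣≡sumOver-1 (image f s) ⟨
      ∣ image f s ∣                              ≡⟨ ∣fs∣≡∣s∣ ⟩
      ∣ s ∣                                      ≡⟨ ∣s∣≡sumOver-1 s ⟩
      sumOver s (λ _ → 1)                        ≡⟨ ∑-fibreSize-* (λ _ → 1) ⟨
      ∑[ y < b ] (fibreSize y * 1)               ≡⟨ sum-cong-≗ (λ y → *-identityʳ (fibreSize y)) ⟩
      ∑[ y < b ] fibreSize y                     ∎

    ∈image≡fibreSize : ∀ y → ⟦ lookup (image f s) y ⟧ ≡ fibreSize y
    ∈image≡fibreSize = ≤∧∑-≡⇒≗ ∈image≤fibreSize ∑∈image≡∑fibreSize

module _ {a} {A : Set a} (w : ℕ → A) where

  Period : ℕ → Set a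
  Period q = ∀ i → w (i + q) ≡ w i

  period-0 : Period 0
  period-0 i = cong w (+-identityʳ i)

  period-+ : ∀ {q q′} → Period q → Period q′ → Period (q + q′)
  period-+ {q} {q′} per per′ i = trans (cong w (sym (+-assoc i q q′))) (trans (per′ (i + q)) (per i))

  period-* : ∀ c {q} → Period q → Period (c * q)
  period-* zero    per = period-0
  period-* (suc c) per = period-+ per (period-* c per)

  period-cancelʳ : ∀ {q q′} → Period q′ → Period (q + q′) → Period q
  period-cancelʳ {q} {q′} per′ per i = trans (sym (per′ (i + q))) (trans (cong w (+-assoc i q q′)) (per i))

  period-gcd : ∀ {q q′} → Period q → Period q′ → Period (gcd q q′)
  period-gcd {q} {q′} per per′ with Bézout.identity (gcd-GCD q q′)
  ... | Bézout.+- x y eq = period-cancelʳ (period-* y per′) (subst Period (sym eq) (period-* x per))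
  ... | Bézout.-+ x y eq = period-cancelʳ (period-* x per) (subst Period (sym eq) (period-* y per′))

  period-% : ∀ {r m m′} .{{_ : NonZero r}} → Period r → Period m → m % r ≡ m′ % r → Period m′
  period-% {r} {m} {m′} perʳ perᵐ m≡m′ = subst Period (sym (m≡m%n+[m/n]*n m′ r))
    (period-+ (subst Period m≡m′ per-m%r) (period-* (m′ / r) perʳ))
    where
    per-m%r : Period (m % r)
    per-m%r = period-cancelʳ (period-* (m / r) perʳ) (subst Period (m≡m%n+[m/n]*n m r) perᵐ)

module _ {n : ℕ} .{{_ : NonZero n}} where

  +-cong-% : ∀ {a b c d} → a % n ≡ b % n → c % n ≡ d % n → (a + c) % n ≡ (b + d) % n
  +-cong-% {a} {b} {c} {d} a≡b c≡d = begin
    (a + c) % n          ≡⟨ %-distribˡ-+ a c n ⟩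
    (a % n + c % n) % n  ≡⟨ cong₂ (λ x y → (x + y) % n) a≡b c≡d ⟩
    (b % n + d % n) % n  ≡⟨ %-distribˡ-+ b d n ⟨
    (b + d) % n          ∎

  [m%n+o]%n≡[m+o]%n : ∀ m o → (m % n + o) % n ≡ (m + o) % n
  [m%n+o]%n≡[m+o]%n m o = +-cong-% {m % n} {m} {o} {o} (m%n%n≡m%n m n) refl

  %-cancelˡ-+ : ∀ x {a b} → (x + a) % n ≡ (x + b) % n → a % n ≡ b % n
  %-cancelˡ-+ x {a} {b} eq = trans (sym (undo a)) (trans (+-cong-% {n ∸ x % n} refl eq) (undo b))
    where
    undo : ∀ z → (n ∸ x % n + (x + z)) % n ≡ z % n
    undo z = begin
      (n ∸ x % n + (x + z)) % n      ≡⟨ +-cong-% {n ∸ x % n} refl ([m%n+o]%n≡[m+o]%n x z) ⟨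
      (n ∸ x % n + (x % n + z)) % n  ≡⟨ cong (_% n) (+-assoc (n ∸ x % n) (x % n) z) ⟨
      (n ∸ x % n + x % n + z) % n    ≡⟨ cong (λ y → (y + z) % n) (m∸n+n≡m (m%n≤n x n)) ⟩
      (n + z) % n                    ≡⟨ %-remove-+ˡ z ∣-refl ⟩
      z % n                          ∎

  toℕ-mod : ∀ x → toℕ (x mod n) ≡ x % n
  toℕ-mod x = toℕ-fromℕ< (m%n<n x n)

  mod-cong : ∀ x y → x % n ≡ y % n → x mod n ≡ y mod n
  mod-cong x y eq = toℕ-injective (trans (toℕ-mod x) (trans eq (sym (toℕ-mod y))))

  mod-toℕ : ∀ (j : Fin n) → toℕ j mod n ≡ j
  mod-toℕ j = toℕ-injective (trans (toℕ-mod (toℕ j)) (m<n⇒m%n≡m (toℕ<n j)))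

  [[m+o]%n+n∸m]%n≡o : ∀ {m o} → m ≤ n → o < n → ((m + o) % n + n ∸ m) % n ≡ o
  [[m+o]%n+n∸m]%n≡o {m} {o} m≤n o<n = begin
    ((m + o) % n + n ∸ m) % n    ≡⟨ cong (_% n) (+-∸-assoc ((m + o) % n) m≤n) ⟩
    ((m + o) % n + (n ∸ m)) % n  ≡⟨ [m%n+o]%n≡[m+o]%n (m + o) (n ∸ m) ⟩
    (m + o + (n ∸ m)) % n        ≡⟨ cong (_% n) m+o+[n∸m]≡o+n ⟩
    (o + n) % n                  ≡⟨ [m+n]%n≡m%n o n ⟩
    o % n                        ≡⟨ m<n⇒m%n≡m o<n ⟩
    o                            ∎
    where
    m+o+[n∸m]≡o+n : m + o + (n ∸ m) ≡ o + n
    m+o+[n∸m]≡o+n = begin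
      m + o + (n ∸ m)    ≡⟨ cong (_+ (n ∸ m)) (+-comm m o) ⟩
      o + m + (n ∸ m)    ≡⟨ +-assoc o m (n ∸ m) ⟩
      o + (m + (n ∸ m))  ≡⟨ cong (o +_) (m+[n∸m]≡n m≤n) ⟩
      o + n              ∎

divBy[m,n]*n≡m : ∀ {m n} → n ∣ m → divBy m n * n ≡ m
divBy[m,n]*n≡m {m} {zero}  0∣m = sym (0∣⇒≡0 0∣m)
divBy[m,n]*n≡m {m} {suc n} n∣m = m/n*n≡m n∣m

sumUpTo : ℕ → (ℕ → ℕ) → ℕ
sumUpTo n F = ∑[ t < n ] F (toℕ t)

sumUpTo-cong : ∀ n {F G : ℕ → ℕ} → (∀ t → t < n → F t ≡ G t) → sumUpTo n F ≡ sumUpTo n G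
sumUpTo-cong n F≡G = sum-cong-≗ (λ t → F≡G (toℕ t) (toℕ<n t))

sumUpTo-const : ∀ n x → sumUpTo n (λ _ → x) ≡ n * x
sumUpTo-const zero    x = refl
sumUpTo-const (suc n) x = cong (x +_) (sumUpTo-const n x)

sumUpTo-+ : ∀ m n F → sumUpTo (m + n) F ≡ sumUpTo m F + sumUpTo n (λ t → F (m + t))
sumUpTo-+ zero    n F = refl
sumUpTo-+ (suc m) n F = trans (cong (F 0 +_) (sumUpTo-+ m n (F ∘ suc))) (sym (+-assoc (F 0) _ _))

sumUpTo-snoc : ∀ n F → sumUpTo (suc n) F ≡ sumUpTo n F + F n
sumUpTo-snoc n F = trans (sum-init-last {n} (F ∘ toℕ))
  (cong₂ _+_ (sum-cong-≗ {n} (cong F ∘ toℕ-inject₁)) (cong F (toℕ-fromℕ n)))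

sumUpTo-slide : ∀ n F i → F i + sumUpTo n (λ t → F (suc i + t)) ≡ sumUpTo n (λ t → F (i + t)) + F (i + n)
sumUpTo-slide n F i = trans
  (cong₂ _+_ (cong F (sym (+-identityʳ i))) (sumUpTo-cong n (λ t _ → cong F (sym (+-suc i t)))))
  (sumUpTo-snoc n (λ t → F (i + t)))

sumUpTo-rotate : ∀ n {F} → Period F n → ∀ i → sumUpTo n (λ t → F (i + t)) ≡ sumUpTo n F
sumUpTo-rotate n     per zero    = refl
sumUpTo-rotate n {F} per (suc i) = trans (+-cancelˡ-≡ (F i) _ _ (begin
  F i + sumUpTo n (λ t → F (suc i + t))     ≡⟨ sumUpTo-slide n F i ⟩
  sumUpTo n (λ t → F (i + t)) + F (i + n)   ≡⟨ cong (sumUpTo n (λ t → F (i + t)) +_) (per i) ⟩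
  sumUpTo n (λ t → F (i + t)) + F i         ≡⟨ +-comm _ (F i) ⟩
  F i + sumUpTo n (λ t → F (i + t))         ∎))
  (sumUpTo-rotate n per i)

sumUpTo-truncate : ∀ {r n} F → r ≤ n → sumUpTo n (λ t → ⟦ ⌊ t <? r ⌋ ⟧ * F t) ≡ sumUpTo r F
sumUpTo-truncate {zero}  {n}     F _         = sum-replicate-zero n
sumUpTo-truncate {suc r} {suc n} F (s≤s r≤n) = cong₂ _+_ (*-identityˡ (F 0)) (trans
  (sum-cong-≗ {n} (λ t → cong (λ b → ⟦ b ⟧ * F (suc (toℕ t))) ⌊1+t<?1+r⌋≡⌊t<?r⌋))
  (sumUpTo-truncate (F ∘ suc) r≤n))
  where
  ⌊1+t<?1+r⌋≡⌊t<?r⌋ : ∀ {t} → ⌊ suc t <? suc r ⌋ ≡ ⌊ t <? r ⌋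
  ⌊1+t<?1+r⌋≡⌊t<?r⌋ {t} = trans (isYes≗does (suc t <? suc r)) (sym (isYes≗does (t <? r)))

module _ {p : ℕ} .{{_ : NonZero p}} where

  sumUpTo-cong-% : ∀ n {F G : ℕ → ℕ} → (∀ t → F t % p ≡ G t % p) → sumUpTo n F % p ≡ sumUpTo n G % p
  sumUpTo-cong-% zero    F≡G = refl
  sumUpTo-cong-% (suc n) F≡G = +-cong-% (F≡G 0) (sumUpTo-cong-% n (F≡G ∘ suc))

  sumUpTo-period-% : ∀ {d} F → Period (λ i → F i % p) d →
                     ∀ q → sumUpTo (q * d) F % p ≡ (q * sumUpTo d F) % p
  sumUpTo-period-% F per zero    = refl
  sumUpTo-period-% {d} F per (suc q) = begin
    sumUpTo (d + q * d) F % p                                ≡⟨ cong (_% p) (sumUpTo-+ d (q * d) F) ⟩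
    (sumUpTo d F + sumUpTo (q * d) (λ t → F (d + t))) % p    ≡⟨ +-cong-% refl shifted ⟩
    (sumUpTo d F + q * sumUpTo d F) % p                      ∎
    where
    shifted : sumUpTo (q * d) (λ t → F (d + t)) % p ≡ (q * sumUpTo d F) % p
    shifted = trans (sumUpTo-cong-% (q * d) (λ t → trans (cong (λ x → F x % p) (+-comm d t)) (per t)))
                    (sumUpTo-period-% F per q)

window-lookup : ∀ m r (i : Fin (suc m)) {t} → t < suc m →
                lookup (window m r i) ((toℕ i + t) mod suc m) ≡ ⌊ t <? r ⌋
window-lookup m r i {t} t<ℓ = begin
  lookup (window m r i) ((toℕ i + t) mod ℓ)
    ≡⟨ lookup∘tabulate (λ j → ⌊ (toℕ j + ℓ ∸ toℕ i) % ℓ <? r ⌋) _ ⟩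
  ⌊ (toℕ ((toℕ i + t) mod ℓ) + ℓ ∸ toℕ i) % ℓ <? r ⌋
    ≡⟨ cong (λ x → ⌊ (x + ℓ ∸ toℕ i) % ℓ <? r ⌋) (toℕ-mod (toℕ i + t)) ⟩
  ⌊ ((toℕ i + t) % ℓ + ℓ ∸ toℕ i) % ℓ <? r ⌋
    ≡⟨ cong (λ x → ⌊ x <? r ⌋) ([[m+o]%n+n∸m]%n≡o (<⇒≤ (toℕ<n i)) t<ℓ) ⟩
  ⌊ t <? r ⌋ ∎
  where
  ℓ = suc m

window-sum : ∀ m r (i : Fin (suc m)) h → r ≤ suc m →
             sumOver (window m r i) h ≡ sumUpTo r (λ t → h ((toℕ i + t) mod suc m))
window-sum m r i h r≤ℓ = begin
  sumOver (window m r i) h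
    ≡⟨ sumOver-∑ (window m r i) h ⟩
  ∑[ j < ℓ ] weight j
    ≡⟨ sum-cong-≗ (λ j → cong weight (mod-toℕ j)) ⟨
  sumUpTo ℓ (weight ∘ (_mod ℓ))
    ≡⟨ sumUpTo-rotate ℓ weight-periodic (toℕ i) ⟨
  sumUpTo ℓ (λ t → weight (shifted t))
    ≡⟨ sumUpTo-cong ℓ (λ t t<ℓ → cong (λ b → ⟦ b ⟧ * h (shifted t)) (window-lookup m r i t<ℓ)) ⟩
  sumUpTo ℓ (λ t → ⟦ ⌊ t <? r ⌋ ⟧ * h (shifted t))
    ≡⟨ sumUpTo-truncate (h ∘ shifted) r≤ℓ ⟩
  sumUpTo r (h ∘ shifted) ∎
  where
  ℓ = suc m

  shifted : ℕ → Fin ℓ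
  shifted t = (toℕ i + t) mod ℓ

  weight : Fin ℓ → ℕ
  weight j = ⟦ lookup (window m r i) j ⟧ * h j

  weight-periodic : Period (weight ∘ (_mod ℓ)) ℓ
  weight-periodic x = cong weight (mod-cong (x + ℓ) x ([m+n]%n≡m%n x ℓ))

tightCycle-uniform : ∀ {ℓ r} → r ≤ ℓ → IsRGraph r (TightCycle ℓ r)
tightCycle-uniform {suc m} {r} r≤ℓ _ (i , refl) = begin
  ∣ window m r i ∣                   ≡⟨ ∣s∣≡sumOver-1 (window m r i) ⟩
  sumOver (window m r i) (λ _ → 1)   ≡⟨ window-sum m r i _ r≤ℓ ⟩
  sumUpTo r (λ _ → 1)                ≡⟨ sumUpTo-const r 1 ⟩
  r * 1                              ≡⟨ *-identityʳ r ⟩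
  r                                  ∎

constrH-uniform : ∀ {r p n} .{{_ : NonZero p}} (part : Fin n → Fin p) → IsRGraph r (ConstrH r p n part)
constrH-uniform part _ = proj₁

sumOver-hom-image : ∀ {r G₁ G₂} (φ : Fin (n G₁) → Fin (n G₂)) → IsHom G₁ G₂ φ →
                    IsRGraph r G₁ → IsRGraph r G₂ → ∀ {e} → Edge G₁ e →
                    ∀ h → sumOver (image φ e) h ≡ sumOver e (h ∘ φ)
sumOver-hom-image φ φ-hom G₁-uniform G₂-uniform {e} e∈G₁ =
  sumOver-image φ e (trans (G₂-uniform _ (φ-hom e e∈G₁)) (sym (G₁-uniform e e∈G₁)))

window-sums≡1⇒p≡1 : ∀ {m r k p} .{{_ : NonZero r}} .{{_ : NonZero p}} →
                    r ≤ suc m → suc m % r ≡ k % r → p ∣ divBy r (gcd r k) →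
                    (c : Fin (suc m) → ℕ) → (∀ i → sumOver (window m r i) c % p ≡ 1 % p) → p ≡ 1
window-sums≡1⇒p≡1 {m} {r} {k} {p} r≤ℓ ℓ≡k p∣q c windows≡1 = ∣1⇒≡1 (m%n≡0⇒n∣m 1 p (begin
  1 % p                  ≡⟨ S≡1 0 ⟨
  sumUpTo r v % p        ≡⟨ cong (λ x → sumUpTo x v % p) (divBy[m,n]*n≡m (gcd[m,n]∣m r k)) ⟨
  sumUpTo (q * d) v % p  ≡⟨ sumUpTo-period-% v period-d q ⟩
  (q * sumUpTo d v) % p  ≡⟨ n∣m⇒m%n≡0 _ p (∣m⇒∣m*n (sumUpTo d v) p∣q) ⟩
  0                      ∎))
  where
  ℓ = suc m
  d = gcd r k
  q = divBy r d

  v : ℕ → ℕ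
  v x = c (x mod ℓ)

  S : ℕ → ℕ
  S i = sumUpTo r (λ t → v (i + t))

  S≡1 : ∀ i → S i % p ≡ 1 % p
  S≡1 i = trans (cong (_% p) (begin
    S i
      ≡⟨ sumUpTo-cong r (λ t _ → cong c (mod-cong (i + t) (toℕ (i mod ℓ) + t) (shift t))) ⟩
    sumUpTo r (λ t → c ((toℕ (i mod ℓ) + t) mod ℓ))
      ≡⟨ window-sum m r (i mod ℓ) c r≤ℓ ⟨
    sumOver (window m r (i mod ℓ)) c ∎))
    (windows≡1 (i mod ℓ))
    where
    shift : ∀ t → (i + t) % ℓ ≡ (toℕ (i mod ℓ) + t) % ℓ
    shift t = begin
      (i + t) % ℓ                ≡⟨ [m%n+o]%n≡[m+o]%n i t ⟨
      (i % ℓ + t) % ℓ            ≡⟨ cong (λ x → (x + t) % ℓ) (toℕ-mod {ℓ} i) ⟨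
      (toℕ (i mod ℓ) + t) % ℓ    ∎

  period-r : Period (λ x → v x % p) r
  period-r i = %-cancelˡ-+ (S i) (begin
    (S i + v (i + r)) % p  ≡⟨ cong (_% p) (sumUpTo-slide r v i) ⟨
    (v i + S (suc i)) % p  ≡⟨ cong (_% p) (+-comm (v i) (S (suc i))) ⟩
    (S (suc i) + v i) % p  ≡⟨ +-cong-% (trans (S≡1 (suc i)) (sym (S≡1 i))) refl ⟩
    (S i + v i) % p        ∎)

  period-ℓ : Period (λ x → v x % p) ℓ
  period-ℓ x = cong (λ j → c j % p) (mod-cong (x + ℓ) x ([m+n]%n≡m%n x ℓ))

  period-d : Period (λ x → v x % p) d
  period-d = period-gcd _ period-r (period-% _ period-r period-ℓ ℓ≡k)

lemma3 : (r k p : ℕ) → 2 ≤ r → .{{_ : NonZero r}} → ¬ (r ∣ k) →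
         2 ≤ p → .{{_ : NonZero p}} →
         p ∣ divBy r (gcd r k) →
         (n : ℕ) (part : Fin n → Fin p) →
         (∀ a b → partSize part a ≤ partSize part b + 1) →
         (ℓ : ℕ) → r < ℓ → ℓ % r ≡ k % r →
         (F : HGraph) → IsRGraph r F → HomImage (TightCycle ℓ r) F →
         ¬ ContainsSubgraph (ConstrH r p n part) F
lemma3 r k p _ _ 2≤p p∣q n part _ (suc m) r<ℓ ℓ≡k F F-uniform (f , f-hom , _) (g , _ , g-hom) =
  >⇒≢ 2≤p (window-sums≡1⇒p≡1 r≤ℓ ℓ≡k p∣q (colour ∘ g ∘ f) window-sum≡1)
  where
  r≤ℓ : r ≤ suc m
  r≤ℓ = <⇒≤ r<ℓ

  colour : Fin n → ℕ
  colour x = suc (toℕ (part x))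

  window-sum≡1 : ∀ i → sumOver (window m r i) (colour ∘ g ∘ f) % p ≡ 1 % p
  window-sum≡1 i = subst (λ x → x % p ≡ 1 % p) sums-agree (proj₂ (g-hom (image f w) fw∈F))
    where
    w = window m r i
    fw∈F : Edge F (image f w)
    fw∈F = f-hom w (i , refl)
    sums-agree : sumOver (image g (image f w)) colour ≡ sumOver w (colour ∘ g ∘ f)
    sums-agree = trans
      (sumOver-hom-image g g-hom F-uniform (constrH-uniform part) fw∈F colour)
      (sumOver-hom-image f f-hom (tightCycle-uniform r≤ℓ) F-uniform (i , refl) (colour ∘ g))
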